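{- Let $p$ be an odd prime and let $a_1, a_2, \dots, a_n$ be positive integers with $T:=\sum_{i=1}^{n} a_i \leq 2(p-1)$. Then \[ \sum_{j=0}^{p-1} \left[ \prod_{i=1}^{n} (j+1)_{a_i} \right] \left[j \sum_{i=1}^{n} \left( H_{a_i+j}^{(1)} - H_{j}^{(1)}\right) + \frac{j^2}{2} \left\{ \left(\sum_{i=1}^{n} \left( H_{a_i+j}^{(1)} - H_{j}^{(1)}\right)\right)^2 - \sum_{i=1}^{n} \left( H_{a_i+j}^{(2)} - H_{j}^{(2)}\right) \right\} \right] \equiv \begin{cases} 0 & \text{if } T< 2(p-1),\\ -1 & \text{if } T=2(p-1), \end{cases} \pmod{p}. \]
   Context: $(a)_0:=1$ and $(a)_k:=a(a+1)\cdots(a+k-1)$ for $k>0$. For positive integers $i,n$, $H^{(i)}_n:=\sum_{j=1}^n j^{ -i}$, and $H^{(i)}_0:=0$. -}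

module Defs where

open import Data.Nat as ℕ using (ℕ; zero; suc; _^_)
open import Data.Nat.Properties using (m^n≢0)
open import Data.Nat.Divisibility using (_∣_)
open import Data.Integer as ℤ using (ℤ; +_)
open import Data.Rational as ℚ using (ℚ; _/_; ↥_; 0ℚ; 1ℚ; _+_; _*_; _-_)
open import Data.List using (List; []; _∷_; map; foldr; upTo)

poch : ℕ → ℕ → ℕ
poch a zero = 1
poch a (suc k) = poch a k ℕ.* (a ℕ.+ k)

H : ℕ → ℕ → ℚ
H i zero = 0ℚ
H i (suc n) = H i n + (+ 1 / (suc n ^ i)) {{m^n≢0 (suc n) i}}

ι : ℕ → ℚ
ι n = + n / 1

sumℚ : List ℚ → ℚ
sumℚ = foldr _+_ 0ℚ

prodℚ : List ℚ → ℚ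
prodℚ = foldr _*_ 1ℚ

-- congruence of rationals modulo p: p divides the numerator (in lowest
-- terms) of q - r, i.e. q - r has p-adic valuation ≥ 1
_≡_[modℚ_] : ℚ → ℚ → ℕ → Set
q ≡ r [modℚ p ] = p ∣ ℤ.∣ ↥ (q - r) ∣

D1 : ℕ → List ℕ → ℚ
D1 j as = sumℚ (map (λ a → H 1 (a ℕ.+ j) - H 1 j) as)

D2 : ℕ → List ℕ → ℚ
D2 j as = sumℚ (map (λ a → H 2 (a ℕ.+ j) - H 2 j) as)

term : ℕ → List ℕ → ℚ
term j as =
  prodℚ (map (λ a → ι (poch (suc j) a)) as)
  * (ι j * D1 j as + (+ (j ℕ.* j) / 2) * (D1 j as * D1 j as - D2 j as))

S : ℕ → List ℕ → ℚ
S p as = sumℚ (map (λ j → term j as) (upTo p))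

module Submission where

-- Lemma 3.16.  Let P(X) = ∏ᵢ (X+1)_{aᵢ}; it is monic with natural
-- coefficients cₖ and has degree T = Σ aᵢ.  At a natural number j,
-- P'/P = Σᵢ (H⁽¹⁾_{aᵢ+j} - H⁽¹⁾_j) and P''/P = (P'/P)² - Σᵢ (H⁽²⁾_{aᵢ+j} - H⁽²⁾_j),
-- so the j-th summand is j·P'(j) + j²·P''(j)/2 = Σₖ cₖ·C(k+1,2)·jᵏ,
-- a natural number, and the whole sum is Σₖ cₖ·C(k+1,2)·Sₖ with the power
-- sums Sₖ = Σ_{j<p} jᵏ.  Modulo p, Sₖ ≡ 0 for k < p-1, S_{p-1} ≡ -1, and
-- S_{k+p} ≡ S_{k+1} (Fermat); moreover C(p,2) ≡ 0 and C(2p-1,2) ≡ 1 for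
-- odd p.  Hence, when T ≤ 2(p-1), only c_{2(p-1)} survives: the sum is
-- ≡ 0 if T < 2(p-1) and ≡ -1 if T = 2(p-1), because P is monic.

module Sums where
  open import Data.Nat using (ℕ; zero; suc; _+_; _*_; _<_)
  open import Data.Nat.Properties
  open import Data.Nat.Tactic.RingSolver using (solve-∀)
  open import Relation.Binary.PropositionalEquality
  open ≡-Reasoning

  sumTo : ℕ → (ℕ → ℕ) → ℕ
  sumTo zero    f = 0
  sumTo (suc n) f = sumTo n f + f n

  sum-cong : ∀ n {f g : ℕ → ℕ} → (∀ i → i < n → f i ≡ g i) → sumTo n f ≡ sumTo n g
  sum-cong zero    f≡g = refl
  sum-cong (suc n) f≡g =
    cong₂ _+_ (sum-cong n (λ i i<n → f≡g i (m<n⇒m<1+n i<n))) (f≡g n (n<1+n n))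

  sum-const : ∀ n c → sumTo n (λ _ → c) ≡ n * c
  sum-const zero    c = refl
  sum-const (suc n) c = trans (cong (_+ c) (sum-const n c)) (+-comm (n * c) c)

  sum-+ : ∀ n (f g : ℕ → ℕ) → sumTo n (λ i → f i + g i) ≡ sumTo n f + sumTo n g
  sum-+ zero    f g = refl
  sum-+ (suc n) f g = begin
    sumTo n (λ i → f i + g i) + (f n + g n) ≡⟨ cong (_+ (f n + g n)) (sum-+ n f g) ⟩
    sumTo n f + sumTo n g + (f n + g n)     ≡⟨ interchange (sumTo n f) (sumTo n g) (f n) (g n) ⟩
    sumTo n f + f n + (sumTo n g + g n)     ∎
    where
    interchange : ∀ a b c d → a + b + (c + d) ≡ a + c + (b + d)
    interchange = solve-∀

  sum-* : ∀ n k (f : ℕ → ℕ) → sumTo n (λ i → k * f i) ≡ k * sumTo n f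
  sum-* zero    k f = sym (*-zeroʳ k)
  sum-* (suc n) k f =
    trans (cong (_+ k * f n) (sum-* n k f)) (sym (*-distribˡ-+ k (sumTo n f) (f n)))

  sum-unfoldˡ : ∀ n (f : ℕ → ℕ) → sumTo (suc n) f ≡ f 0 + sumTo n (λ i → f (suc i))
  sum-unfoldˡ zero    f = sym (+-identityʳ (f 0))
  sum-unfoldˡ (suc n) f =
    trans (cong (_+ f (suc n)) (sum-unfoldˡ n f)) (+-assoc (f 0) _ (f (suc n)))

  sum-swap : ∀ n m (f : ℕ → ℕ → ℕ) →
    sumTo n (λ i → sumTo m (f i)) ≡ sumTo m (λ k → sumTo n (λ i → f i k))
  sum-swap zero    m f = sym (trans (sum-const m 0) (*-zeroʳ m))
  sum-swap (suc n) m f =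
    trans (cong (_+ sumTo m (f n)) (sum-swap n m f))
          (sym (sum-+ m (λ k → sumTo n (λ i → f i k)) (f n)))

  -- Telescoping, in the additive form valid over ℕ.
  sum-telescope : ∀ n (f : ℕ → ℕ) → sumTo n (λ i → f (suc i)) + f 0 ≡ sumTo n f + f n
  sum-telescope zero    f = refl
  sum-telescope (suc n) f = begin
    sumTo n f⁺ + f (suc n) + f 0   ≡⟨ swap₂₃ (sumTo n f⁺) (f (suc n)) (f 0) ⟩
    sumTo n f⁺ + f 0 + f (suc n)   ≡⟨ cong (_+ f (suc n)) (sum-telescope n f) ⟩
    sumTo n f + f n + f (suc n)    ∎
    where
    f⁺ : ℕ → ℕ
    f⁺ i = f (suc i)
    swap₂₃ : ∀ a b c → a + b + c ≡ a + c + b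
    swap₂₃ = solve-∀

module Binomial where
  open import Data.Nat using (ℕ; zero; suc; _+_; _*_; _^_; s≤s; z≤n)
  open import Data.Nat.Properties
  open import Data.Nat.Combinatorics using (_C_; nC1≡n; k>n⇒nCk≡0; nCk+nC[k+1]≡[n+1]C[k+1])
  open import Data.Nat.Tactic.RingSolver using (solve-∀)
  open import Relation.Binary.PropositionalEquality
  open ≡-Reasoning
  open Sums

  pascal : ∀ n k → suc n C suc k ≡ n C k + n C suc k
  pascal n k = sym (nCk+nC[k+1]≡[n+1]C[k+1] n k)

  -- The absorption identity (k+1)·C(n+1,k+1) = (n+1)·C(n,k); it shows that
  -- a prime p divides C(p,k) for 0 < k < p.
  C-absorb : ∀ n k → suc k * (suc n C suc k) ≡ suc n * (n C k)
  C-absorb zero    zero    = refl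
  C-absorb zero    (suc k) = begin
    suc (suc k) * (1 C suc (suc k)) ≡⟨ cong (suc (suc k) *_) (k>n⇒nCk≡0 {1} {suc (suc k)} (s≤s (s≤s z≤n))) ⟩
    suc (suc k) * 0                  ≡⟨ *-zeroʳ (suc (suc k)) ⟩
    0                                ≡⟨ sym (k>n⇒nCk≡0 {0} {suc k} (s≤s z≤n)) ⟩
    0 C suc k                        ≡⟨ sym (*-identityˡ (0 C suc k)) ⟩
    1 * (0 C suc k)                  ∎
  C-absorb (suc n) zero    = trans (+-identityʳ (suc (suc n) C 1))
                                   (trans (nC1≡n (suc (suc n))) (sym (*-identityʳ (suc (suc n)))))
  C-absorb (suc n) (suc k) = begin
    suc (suc k) * (suc (suc n) C suc (suc k))
      ≡⟨ cong (suc (suc k) *_) (pascal (suc n) (suc k)) ⟩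
    suc (suc k) * (suc n C suc k + suc n C suc (suc k))
      ≡⟨ split k (suc n C suc k) (suc n C suc (suc k)) ⟩
    suc k * (suc n C suc k) + suc n C suc k + suc (suc k) * (suc n C suc (suc k))
      ≡⟨ cong₂ (λ u v → u + suc n C suc k + v) (C-absorb n k) (C-absorb n (suc k)) ⟩
    suc n * (n C k) + suc n C suc k + suc n * (n C suc k)
      ≡⟨ cong (λ c → suc n * (n C k) + c + suc n * (n C suc k)) (pascal n k) ⟩
    suc n * (n C k) + (n C k + n C suc k) + suc n * (n C suc k)
      ≡⟨ merge n (n C k) (n C suc k) ⟩
    suc (suc n) * (n C k + n C suc k)
      ≡⟨ cong (suc (suc n) *_) (sym (pascal n k)) ⟩
    suc (suc n) * (suc n C suc k) ∎
    where
    split : ∀ k a b → suc (suc k) * (a + b) ≡ suc k * a + a + suc (suc k) * b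
    split = solve-∀
    merge : ∀ n a b → suc n * a + (a + b) + suc n * b ≡ suc (suc n) * (a + b)
    merge = solve-∀

  binomial : ∀ n x → suc x ^ n ≡ sumTo (suc n) (λ k → (n C k) * x ^ k)
  binomial zero    x = refl
  binomial (suc n) x = begin
    suc x * suc x ^ n
      ≡⟨ cong (suc x *_) (binomial n x) ⟩
    sumTo (suc n) t + x * sumTo (suc n) t
      ≡⟨ cong₂ _+_ (sum-unfoldˡ n t) (sym (sum-* (suc n) x t)) ⟩
    1 * 1 + sumTo n (λ i → t (suc i)) + sumTo (suc n) (λ i → x * t i)
      ≡⟨ cong₂ (λ u v → 1 + u + v) (sym top-vanishes) (sum-cong (suc n) (λ i _ → shift i)) ⟩
    1 + sumTo (suc n) (λ i → (n C suc i) * x ^ suc i) + sumTo (suc n) (λ i → (n C i) * x ^ suc i)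
      ≡⟨ cong (1 +_) (sym (sum-+ (suc n) (λ i → (n C suc i) * x ^ suc i) (λ i → (n C i) * x ^ suc i))) ⟩
    1 + sumTo (suc n) (λ i → (n C suc i) * x ^ suc i + (n C i) * x ^ suc i)
      ≡⟨ cong (1 +_) (sum-cong (suc n) (λ i _ → combine i)) ⟩
    1 + sumTo (suc n) (λ i → (suc n C suc i) * x ^ suc i)
      ≡⟨ sym (sum-unfoldˡ (suc n) (λ k → (suc n C k) * x ^ k)) ⟩
    sumTo (suc (suc n)) (λ k → (suc n C k) * x ^ k) ∎
    where
    t : ℕ → ℕ
    t k = (n C k) * x ^ k
    top-vanishes : sumTo (suc n) (λ i → t (suc i)) ≡ sumTo n (λ i → t (suc i))
    top-vanishes = begin
      sumTo n (λ i → t (suc i)) + (n C suc n) * x ^ suc n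
        ≡⟨ cong (λ c → sumTo n (λ i → t (suc i)) + c * x ^ suc n) (k>n⇒nCk≡0 (n<1+n n)) ⟩
      sumTo n (λ i → t (suc i)) + 0
        ≡⟨ +-identityʳ _ ⟩
      sumTo n (λ i → t (suc i)) ∎
    shift : ∀ i → x * t i ≡ (n C i) * x ^ suc i
    shift i = x*[c*y]≡c*[x*y] x (n C i) (x ^ i)
      where
      x*[c*y]≡c*[x*y] : ∀ x c y → x * (c * y) ≡ c * (x * y)
      x*[c*y]≡c*[x*y] = solve-∀
    combine : ∀ i → (n C suc i) * x ^ suc i + (n C i) * x ^ suc i ≡ (suc n C suc i) * x ^ suc i
    combine i = trans (sym (*-distribʳ-+ (x ^ suc i) (n C suc i) (n C i)))
                      (cong (_* x ^ suc i) (trans (+-comm (n C suc i) (n C i)) (sym (pascal n i))))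

module Poly where
  open import Data.Nat using (ℕ; zero; suc; _+_; _*_; _^_; _<_; s≤s)
  open import Data.Nat.Properties
  open import Data.Nat.Tactic.RingSolver using (solve-∀)
  open import Data.Nat.ListAction using (sum)
  open import Data.List using (List; []; _∷_; map)
  open import Data.Product using (_×_; _,_)
  open import Relation.Binary.PropositionalEquality
  open ≡-Reasoning

  -- Triangular numbers tri k = C(k+1,2); these are the weights that turn
  -- x·P'(x) + x²·P''(x)/2 into Σ tri(k) cₖ xᵏ.
  tri : ℕ → ℕ
  tri zero    = 0
  tri (suc n) = tri n + suc n

  tri-closed : ∀ n → tri n * 2 ≡ n * suc n
  tri-closed zero    = refl
  tri-closed (suc n) = begin
    (tri n + suc n) * 2   ≡⟨ *-distribʳ-+ 2 (tri n) (suc n) ⟩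
    tri n * 2 + suc n * 2 ≡⟨ cong (_+ suc n * 2) (tri-closed n) ⟩
    n * suc n + suc n * 2 ≡⟨ step n ⟩
    suc n * suc (suc n)   ∎
    where
    step : ∀ n → n * suc n + suc n * 2 ≡ suc n * suc (suc n)
    step = solve-∀

  -- A polynomial with natural coefficients is its coefficient list
  -- c₀ ∷ c₁ ∷ …, lowest degree first.
  evalW : (ℕ → ℕ) → ℕ → List ℕ → ℕ → ℕ
  evalW w o []       x = 0
  evalW w o (c ∷ cs) x = c * w o * x ^ o + evalW w (suc o) cs x

  -- The three weights used below: evalW one 0 c x = P(x),
  -- evalW idw 0 c x = x·P'(x) and evalW tri 0 c x = x·P'(x) + x²·P''(x)/2.
  one : ℕ → ℕ
  one _ = 1

  idw : ℕ → ℕ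
  idw n = n

  _⊕_ : List ℕ → List ℕ → List ℕ
  []       ⊕ R        = R
  (c ∷ P)  ⊕ []       = c ∷ P
  (c ∷ P)  ⊕ (d ∷ R)  = (c + d) ∷ (P ⊕ R)

  scale : ℕ → List ℕ → List ℕ
  scale k = map (k *_)

  linMul : ℕ → List ℕ → List ℕ
  linMul k P = (0 ∷ P) ⊕ scale k P

  pochMul : ℕ → List ℕ → List ℕ
  pochMul zero    P = P
  pochMul (suc a) P = linMul (suc a) (pochMul a P)

  pochProd : List ℕ → List ℕ
  pochProd []       = 1 ∷ []
  pochProd (a ∷ as) = pochMul a (pochProd as)

  module Evaluation (x : ℕ) where

    evalW-⊕ : ∀ w o P R → evalW w o (P ⊕ R) x ≡ evalW w o P x + evalW w o R x
    evalW-⊕ w o []      R       = refl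
    evalW-⊕ w o (c ∷ P) []      = sym (+-identityʳ _)
    evalW-⊕ w o (c ∷ P) (d ∷ R) rewrite evalW-⊕ w (suc o) P R =
      distrib c d (w o) (x ^ o) (evalW w (suc o) P x) (evalW w (suc o) R x)
      where
      distrib : ∀ c d a b u v → (c + d) * a * b + (u + v) ≡ (c * a * b + u) + (d * a * b + v)
      distrib = solve-∀

    evalW-scale : ∀ w o k P → evalW w o (scale k P) x ≡ k * evalW w o P x
    evalW-scale w o k []      = sym (*-zeroʳ k)
    evalW-scale w o k (c ∷ P) rewrite evalW-scale w (suc o) k P =
      distrib k c (w o) (x ^ o) (evalW w (suc o) P x)
      where
      distrib : ∀ k c a b u → k * c * a * b + k * u ≡ k * (c * a * b + u)
      distrib = solve-∀

    evalW-zero : ∀ o P → evalW (λ _ → 0) o P x ≡ 0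
    evalW-zero o []      = refl
    evalW-zero o (c ∷ P) rewrite evalW-zero (suc o) P | *-zeroʳ c = refl

    evalW-+ : ∀ f g o P → evalW (λ n → f n + g n) o P x ≡ evalW f o P x + evalW g o P x
    evalW-+ f g o []      = refl
    evalW-+ f g o (c ∷ P) rewrite evalW-+ f g (suc o) P =
      distrib c (f o) (g o) (x ^ o) (evalW f (suc o) P x) (evalW g (suc o) P x)
      where
      distrib : ∀ c a b y u v → c * (a + b) * y + (u + v) ≡ (c * a * y + u) + (c * b * y + v)
      distrib = solve-∀

    evalW-shift : ∀ w v → (∀ n → w (suc n) ≡ w n + v n) → ∀ o P →
      evalW w (suc o) P x ≡ x * (evalW w o P x + evalW v o P x)
    evalW-shift w v w-step o []      = sym (*-zeroʳ x)
    evalW-shift w v w-step o (c ∷ P) rewrite evalW-shift w v w-step (suc o) P | w-step o =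
      distrib c (w o) (v o) x (x ^ o) (evalW w (suc o) P x) (evalW v (suc o) P x)
      where
      distrib : ∀ c a b x y u v → c * (a + b) * (x * y) + x * (u + v)
                                ≡ x * ((c * a * y + u) + (c * b * y + v))
      distrib = solve-∀

    evalW-linMul : ∀ w k P → evalW w 0 (linMul k P) x ≡ evalW w 1 P x + k * evalW w 0 P x
    evalW-linMul w k P =
      trans (evalW-⊕ w 0 (0 ∷ P) (scale k P)) (cong (evalW w 1 P x +_) (evalW-scale w 0 k P))

    leibniz-one : ∀ k P → evalW one 0 (linMul k P) x
                        ≡ x * evalW one 0 P x + k * evalW one 0 P x
    leibniz-one k P = begin
      evalW one 0 (linMul k P) x               ≡⟨ evalW-linMul one k P ⟩
      evalW one 1 P x + k * F                  ≡⟨ cong (_+ k * F) (evalW-shift one (λ _ → 0) (λ _ → refl) 0 P) ⟩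
      x * (F + evalW (λ _ → 0) 0 P x) + k * F  ≡⟨ cong (λ z → x * (F + z) + k * F) (evalW-zero 0 P) ⟩
      x * (F + 0) + k * F                      ≡⟨ cong (λ z → x * z + k * F) (+-identityʳ F) ⟩
      x * F + k * F                            ∎
      where
      F : ℕ
      F = evalW one 0 P x

    leibniz-id : ∀ k P → evalW idw 0 (linMul k P) x
                       ≡ x * (evalW idw 0 P x + evalW one 0 P x) + k * evalW idw 0 P x
    leibniz-id k P = trans (evalW-linMul idw k P)
      (cong (_+ k * evalW idw 0 P x) (evalW-shift idw one (λ n → +-comm 1 n) 0 P))

    leibniz-tri : ∀ k P → evalW tri 0 (linMul k P) x
                        ≡ x * (evalW tri 0 P x + (evalW idw 0 P x + evalW one 0 P x)) + k * evalW tri 0 P x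
    leibniz-tri k P = begin
      evalW tri 0 (linMul k P) x
        ≡⟨ evalW-linMul tri k P ⟩
      evalW tri 1 P x + k * B
        ≡⟨ cong (_+ k * B) (evalW-shift tri (λ n → idw n + one n) (λ n → cong (tri n +_) (+-comm 1 n)) 0 P) ⟩
      x * (B + evalW (λ n → idw n + one n) 0 P x) + k * B
        ≡⟨ cong (λ z → x * (B + z) + k * B) (evalW-+ idw one 0 P) ⟩
      x * (B + (evalW idw 0 P x + evalW one 0 P x)) + k * B ∎
      where
      B : ℕ
      B = evalW tri 0 P x

  coef : List ℕ → ℕ → ℕ
  coef []       _       = 0
  coef (c ∷ _)  zero    = c
  coef (_ ∷ cs) (suc i) = coef cs i

  coef-⊕ : ∀ P R i → coef (P ⊕ R) i ≡ coef P i + coef R i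
  coef-⊕ []      R       i       = refl
  coef-⊕ (c ∷ P) []      i       = sym (+-identityʳ _)
  coef-⊕ (c ∷ P) (d ∷ R) zero    = refl
  coef-⊕ (c ∷ P) (d ∷ R) (suc i) = coef-⊕ P R i

  coef-scale : ∀ k P i → coef (scale k P) i ≡ k * coef P i
  coef-scale k []      i       = sym (*-zeroʳ k)
  coef-scale k (c ∷ P) zero    = refl
  coef-scale k (c ∷ P) (suc i) = coef-scale k P i

  coef-linMul : ∀ k P i → coef (linMul k P) (suc i) ≡ coef P i + k * coef P (suc i)
  coef-linMul k P i =
    trans (coef-⊕ (0 ∷ P) (scale k P) (suc i)) (cong (coef P i +_) (coef-scale k P (suc i)))

  Monic : ℕ → List ℕ → Set
  Monic d P = (∀ i → d < i → coef P i ≡ 0) × (coef P d ≡ 1)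

  monic-linMul : ∀ k d P → Monic d P → Monic (suc d) (linMul k P)
  monic-linMul k d P (above , lead) = above′ , lead′
    where
    above′ : ∀ i → suc d < i → coef (linMul k P) i ≡ 0
    above′ (suc i) (s≤s d<i) = begin
      coef (linMul k P) (suc i)          ≡⟨ coef-linMul k P i ⟩
      coef P i + k * coef P (suc i)      ≡⟨ cong₂ (λ u v → u + k * v) (above i d<i) (above (suc i) (m<n⇒m<1+n d<i)) ⟩
      0 + k * 0                          ≡⟨ *-zeroʳ k ⟩
      0                                  ∎
    lead′ : coef (linMul k P) (suc d) ≡ 1
    lead′ = begin
      coef (linMul k P) (suc d)          ≡⟨ coef-linMul k P d ⟩
      coef P d + k * coef P (suc d)      ≡⟨ cong₂ (λ u v → u + k * v) lead (above (suc d) (n<1+n d)) ⟩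
      1 + k * 0                          ≡⟨ cong suc (*-zeroʳ k) ⟩
      1                                  ∎

  monic-pochMul : ∀ a d P → Monic d P → Monic (a + d) (pochMul a P)
  monic-pochMul zero    d P m = m
  monic-pochMul (suc a) d P m = monic-linMul (suc a) (a + d) (pochMul a P) (monic-pochMul a d P m)

  monic-pochProd : ∀ as → Monic (sum as) (pochProd as)
  monic-pochProd []       = (λ { (suc i) _ → refl }) , refl
  monic-pochProd (a ∷ as) = monic-pochMul a (sum as) (pochProd as) (monic-pochProd as)

module Embed where
  open import Defs using (ι; H)
  open import Data.Nat as ℕ using (ℕ; suc)
  import Data.Nat.Properties as ℕ
  import Data.Nat.Coprimality as Coprime
  open import Data.Integer as ℤ using (+_)
  import Data.Integer.Properties as ℤ
  open import Data.Integer.Tactic.RingSolver using (solve-∀)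
  open import Data.Rational as ℚ using (ℚ; _/_; ↥_; 1ℚ; _+_; _*_)
  import Data.Rational.Properties as ℚ
  open import Data.Rational.Unnormalised as ℚᵘ using (ℚᵘ; mkℚᵘ; *≡*)
  import Data.Rational.Unnormalised.Properties as ℚᵘ
  open import Relation.Binary.PropositionalEquality

  -- Normalisation ℚᵘ → ℚ preserves sums and products, and identifies
  -- cross-multiplication-equal fractions; note that fromℚᵘ (mkℚᵘ i d)
  -- is i / (d + 1) by definition.
  fromℚᵘ-+ : ∀ u v → ℚ.fromℚᵘ u + ℚ.fromℚᵘ v ≡ ℚ.fromℚᵘ (u ℚᵘ.+ v)
  fromℚᵘ-+ u v = ℚ.toℚᵘ-injective
    (ℚᵘ.≃-trans (ℚ.toℚᵘ-homo-+ (ℚ.fromℚᵘ u) (ℚ.fromℚᵘ v))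
    (ℚᵘ.≃-trans (ℚᵘ.+-cong (ℚ.toℚᵘ-fromℚᵘ u) (ℚ.toℚᵘ-fromℚᵘ v))
                (ℚᵘ.≃-sym (ℚ.toℚᵘ-fromℚᵘ (u ℚᵘ.+ v)))))

  fromℚᵘ-* : ∀ u v → ℚ.fromℚᵘ u * ℚ.fromℚᵘ v ≡ ℚ.fromℚᵘ (u ℚᵘ.* v)
  fromℚᵘ-* u v = ℚ.toℚᵘ-injective
    (ℚᵘ.≃-trans (ℚ.toℚᵘ-homo-* (ℚ.fromℚᵘ u) (ℚ.fromℚᵘ v))
    (ℚᵘ.≃-trans (ℚᵘ.*-cong (ℚ.toℚᵘ-fromℚᵘ u) (ℚ.toℚᵘ-fromℚᵘ v))
                (ℚᵘ.≃-sym (ℚ.toℚᵘ-fromℚᵘ (u ℚᵘ.* v)))))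

  fromℚᵘ-cross : ∀ u v → ℚᵘ.↥ u ℤ.* ℚᵘ.↧ v ≡ ℚᵘ.↥ v ℤ.* ℚᵘ.↧ u → ℚ.fromℚᵘ u ≡ ℚ.fromℚᵘ v
  fromℚᵘ-cross u v eq = ℚ.fromℚᵘ-cong {u} {v} (*≡* eq)

  ι-+ : ∀ a b → ι (a ℕ.+ b) ≡ ι a + ι b
  ι-+ a b = sym (trans (fromℚᵘ-+ (mkℚᵘ (+ a) 0) (mkℚᵘ (+ b) 0))
                       (fromℚᵘ-cross (mkℚᵘ (+ a) 0 ℚᵘ.+ mkℚᵘ (+ b) 0) (mkℚᵘ (+ (a ℕ.+ b)) 0) (cong (ℤ._* + 1) numerators)))
    where
    numerators : + a ℤ.* + 1 ℤ.+ + b ℤ.* + 1 ≡ + (a ℕ.+ b)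
    numerators = trans (cong₂ ℤ._+_ (ℤ.*-identityʳ (+ a)) (ℤ.*-identityʳ (+ b))) (sym (ℤ.pos-+ a b))

  ι-* : ∀ a b → ι (a ℕ.* b) ≡ ι a * ι b
  ι-* a b = sym (trans (fromℚᵘ-* (mkℚᵘ (+ a) 0) (mkℚᵘ (+ b) 0))
                       (fromℚᵘ-cross (mkℚᵘ (+ a) 0 ℚᵘ.* mkℚᵘ (+ b) 0) (mkℚᵘ (+ (a ℕ.* b)) 0) (cong (ℤ._* + 1) (sym (ℤ.pos-* a b)))))

  ↥ι : ∀ n → ↥ (ι n) ≡ + n
  ↥ι n = cong ↥_ (ℚ.normalize-coprime {n} {0} (Coprime.sym (Coprime.1-coprimeTo n)))

  reciprocal : ℕ → ℚ
  reciprocal t = + 1 / suc t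

  reciprocal-inverse : ∀ t → reciprocal t * ι (suc t) ≡ 1ℚ
  reciprocal-inverse t = trans (fromℚᵘ-* (mkℚᵘ (+ 1) t) (mkℚᵘ (+ suc t) 0))
                               (fromℚᵘ-cross (mkℚᵘ (+ 1) t ℚᵘ.* mkℚᵘ (+ suc t) 0) (mkℚᵘ (+ 1) 0) cross)
    where
    cross : (+ 1 ℤ.* + suc t) ℤ.* + 1 ≡ + 1 ℤ.* + (suc t ℕ.* 1)
    cross = trans (ℤ.*-identityʳ _) (cong (λ z → + 1 ℤ.* + z) (sym (ℕ.*-identityʳ (suc t))))

  half-square : ∀ j → (+ (j ℕ.* j) / 2) + (+ (j ℕ.* j) / 2) ≡ ι j * ι j
  half-square j = begin
    (+ (j ℕ.* j) / 2) + (+ (j ℕ.* j) / 2)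
      ≡⟨ fromℚᵘ-+ (mkℚᵘ (+ (j ℕ.* j)) 1) (mkℚᵘ (+ (j ℕ.* j)) 1) ⟩
    ℚ.fromℚᵘ (mkℚᵘ (+ (j ℕ.* j)) 1 ℚᵘ.+ mkℚᵘ (+ (j ℕ.* j)) 1)
      ≡⟨ fromℚᵘ-cross (mkℚᵘ (+ (j ℕ.* j)) 1 ℚᵘ.+ mkℚᵘ (+ (j ℕ.* j)) 1) (mkℚᵘ (+ j) 0 ℚᵘ.* mkℚᵘ (+ j) 0) cross ⟩
    ℚ.fromℚᵘ (mkℚᵘ (+ j) 0 ℚᵘ.* mkℚᵘ (+ j) 0)
      ≡⟨ sym (fromℚᵘ-* (mkℚᵘ (+ j) 0) (mkℚᵘ (+ j) 0)) ⟩
    ι j * ι j ∎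
    where
    open ≡-Reasoning
    identity : ∀ x → (x ℤ.* x ℤ.* + 2 ℤ.+ x ℤ.* x ℤ.* + 2) ℤ.* + 1 ≡ (x ℤ.* x) ℤ.* + 4
    identity = solve-∀
    cross : (+ (j ℕ.* j) ℤ.* + 2 ℤ.+ + (j ℕ.* j) ℤ.* + 2) ℤ.* + 1 ≡ (+ j ℤ.* + j) ℤ.* + 4
    cross = trans (cong (λ z → (z ℤ.* + 2 ℤ.+ z ℤ.* + 2) ℤ.* + 1) (ℤ.pos-* j j)) (identity (+ j))

  H₁-step : ∀ t → H 1 (suc t) ≡ H 1 t + reciprocal t
  H₁-step t = cong (λ z → H 1 t + z)
    (ℚ./-cong {+ 1} {suc t ℕ.^ 1} {+ 1} {suc t} {{ℕ.m^n≢0 (suc t) 1}} refl (ℕ.*-identityʳ (suc t)))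

  H₂-step : ∀ t → H 2 (suc t) ≡ H 2 t + reciprocal t * reciprocal t
  H₂-step t = cong (λ z → H 2 t + z) (trans
    (ℚ./-cong {+ 1} {suc t ℕ.^ 2} {+ 1} {suc t ℕ.* suc t} {{ℕ.m^n≢0 (suc t) 2}}
              refl (cong (suc t ℕ.*_) (ℕ.*-identityʳ (suc t))))
    (sym (fromℚᵘ-* (mkℚᵘ (+ 1) t) (mkℚᵘ (+ 1) t))))

module Summand where
  open import Defs
  open Poly
  open Embed
  open import Data.Nat as ℕ using (ℕ; zero; suc)
  import Data.Nat.Properties as ℕ
  open import Data.Integer using (+_)
  open import Data.Rational as ℚ using (ℚ; _/_; 0ℚ; 1ℚ; _+_; _*_; _-_)
  import Data.Rational.Properties as ℚ
  open import Data.Rational.Solver using (module +-*-Solver)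
  open import Data.List using (List; []; _∷_; map)
  open import Data.Product using (_×_; _,_; proj₂)
  open import Relation.Binary.PropositionalEquality
  open ≡-Reasoning
  open +-*-Solver

  -- Field identities behind multiplying a product P by a new linear factor
  -- X + K, where d1 plays the role of P'/P and d1² - d2 that of P''/P:
  -- the factor adds e = 1/(X+K) to d1 and e² to d2.
  module LinearFactor (P d1 d2 X K e h : ℚ) (e-inv : e * (X + K) ≡ 1ℚ) (h-half : h + h ≡ X * X) where

    value-step : P * (X + K) ≡ X * P + K * P
    value-step = solve 3 (λ P X K → P :* (X :+ K) := X :* P :+ K :* P) refl P X K

    derivative-step : X * (P * (X + K)) * (d1 + e) ≡ X * (X * P * d1 + P) + K * (X * P * d1)
    derivative-step = begin
      X * (P * (X + K)) * (d1 + e)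
        ≡⟨ solve 5 (λ P d1 X K e → X :* (P :* (X :+ K)) :* (d1 :+ e)
                     := X :* P :* (X :+ K) :* d1 :+ X :* P :* (e :* (X :+ K))) refl P d1 X K e ⟩
      X * P * (X + K) * d1 + X * P * (e * (X + K))
        ≡⟨ cong (λ u → X * P * (X + K) * d1 + X * P * u) e-inv ⟩
      X * P * (X + K) * d1 + X * P * 1ℚ
        ≡⟨ solve 4 (λ P d1 X K → X :* P :* (X :+ K) :* d1 :+ X :* P :* con 1ℚ
                     := X :* (X :* P :* d1 :+ P) :+ K :* (X :* P :* d1)) refl P d1 X K ⟩
      X * (X * P * d1 + P) + K * (X * P * d1) ∎

    combined-step :
      (P * (X + K)) * (X * (d1 + e) + h * ((d1 + e) * (d1 + e) - (d2 + e * e)))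
        ≡ X * (P * (X * d1 + h * (d1 * d1 - d2)) + (X * P * d1 + P)) + K * (P * (X * d1 + h * (d1 * d1 - d2)))
    combined-step = begin
      (P * (X + K)) * (X * (d1 + e) + h * ((d1 + e) * (d1 + e) - (d2 + e * e)))
        ≡⟨ solve 7 (λ P d1 d2 X K e h →
             (P :* (X :+ K)) :* (X :* (d1 :+ e) :+ h :* ((d1 :+ e) :* (d1 :+ e) :- (d2 :+ e :* e)))
             := (X :+ K) :* (P :* (X :* d1 :+ h :* (d1 :* d1 :- d2))) :+ (e :* (X :+ K)) :* (X :* P)
                :+ (e :* (X :+ K)) :* ((h :+ h) :* P :* d1)) refl P d1 d2 X K e h ⟩
      (X + K) * B + (e * (X + K)) * (X * P) + (e * (X + K)) * ((h + h) * P * d1)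
        ≡⟨ cong₂ (λ u v → (X + K) * B + u * (X * P) + u * (v * P * d1)) e-inv h-half ⟩
      (X + K) * B + 1ℚ * (X * P) + 1ℚ * ((X * X) * P * d1)
        ≡⟨ solve 6 (λ P d1 d2 X K h →
             (X :+ K) :* (P :* (X :* d1 :+ h :* (d1 :* d1 :- d2))) :+ con 1ℚ :* (X :* P) :+ con 1ℚ :* ((X :* X) :* P :* d1)
             := X :* ((P :* (X :* d1 :+ h :* (d1 :* d1 :- d2))) :+ (X :* P :* d1 :+ P)) :+ K :* (P :* (X :* d1 :+ h :* (d1 :* d1 :- d2)))) refl P d1 d2 X K h ⟩
      X * (B + (X * P * d1 + P)) + K * B ∎
      where
      B : ℚ
      B = P * (X * d1 + h * (d1 * d1 - d2))

  ι-affine : ∀ a b u v → ι (a ℕ.* u ℕ.+ b ℕ.* v) ≡ ι a * ι u + ι b * ι v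
  ι-affine a b u v = trans (ι-+ (a ℕ.* u) (b ℕ.* v)) (cong₂ _+_ (ι-* a u) (ι-* b v))

  module AtPoint (j : ℕ) where
    open Evaluation j

    X : ℚ
    X = ι j

    h : ℚ
    h = + (j ℕ.* j) / 2

    Represents : ℚ → ℚ → ℚ → List ℕ → Set
    Represents P d1 d2 c =
      (P ≡ ι (evalW one 0 c j)) ×
      (X * P * d1 ≡ ι (evalW idw 0 c j)) ×
      (P * (X * d1 + h * (d1 * d1 - d2)) ≡ ι (evalW tri 0 c j))

    represents-cong : ∀ {P P′ d1 d1′ d2 d2′} c → P ≡ P′ → d1 ≡ d1′ → d2 ≡ d2′ →
      Represents P d1 d2 c → Represents P′ d1′ d2′ c
    represents-cong c refl refl refl r = r

    represents-linMul : ∀ k e {P d1 d2 c} → e * (X + ι k) ≡ 1ℚ → Represents P d1 d2 c →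
      Represents (P * (X + ι k)) (d1 + e) (d2 + e * e) (linMul k c)
    represents-linMul k e {P} {d1} {d2} {c} e-inv (value , derivative , combined) =
      value′ , derivative′ , combined′
      where
      open LinearFactor P d1 d2 X (ι k) e h e-inv (half-square j)
      F A B : ℕ
      F = evalW one 0 c j
      A = evalW idw 0 c j
      B = evalW tri 0 c j
      value′ : P * (X + ι k) ≡ ι (evalW one 0 (linMul k c) j)
      value′ = begin
        P * (X + ι k)          ≡⟨ value-step ⟩
        X * P + ι k * P        ≡⟨ cong₂ (λ u v → X * u + ι k * v) value value ⟩
        X * ι F + ι k * ι F    ≡⟨ sym (ι-affine j k F F) ⟩
        ι (j ℕ.* F ℕ.+ k ℕ.* F) ≡⟨ cong ι (sym (leibniz-one k c)) ⟩
        ι (evalW one 0 (linMul k c) j) ∎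
      derivative′ : X * (P * (X + ι k)) * (d1 + e) ≡ ι (evalW idw 0 (linMul k c) j)
      derivative′ = begin
        X * (P * (X + ι k)) * (d1 + e)                  ≡⟨ derivative-step ⟩
        X * (X * P * d1 + P) + ι k * (X * P * d1)       ≡⟨ cong₂ (λ u v → X * (u + v) + ι k * u) derivative value ⟩
        X * (ι A + ι F) + ι k * ι A                     ≡⟨ cong (λ z → X * z + ι k * ι A) (sym (ι-+ A F)) ⟩
        X * ι (A ℕ.+ F) + ι k * ι A                     ≡⟨ sym (ι-affine j k (A ℕ.+ F) A) ⟩
        ι (j ℕ.* (A ℕ.+ F) ℕ.+ k ℕ.* A)                 ≡⟨ cong ι (sym (leibniz-id k c)) ⟩
        ι (evalW idw 0 (linMul k c) j) ∎
      combined′ : (P * (X + ι k)) * (X * (d1 + e) + h * ((d1 + e) * (d1 + e) - (d2 + e * e)))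
                  ≡ ι (evalW tri 0 (linMul k c) j)
      combined′ = begin
        (P * (X + ι k)) * (X * (d1 + e) + h * ((d1 + e) * (d1 + e) - (d2 + e * e)))
          ≡⟨ combined-step ⟩
        X * (P * (X * d1 + h * (d1 * d1 - d2)) + (X * P * d1 + P)) + ι k * (P * (X * d1 + h * (d1 * d1 - d2)))
          ≡⟨ cong₃ combined derivative value ⟩
        X * (ι B + (ι A + ι F)) + ι k * ι B
          ≡⟨ cong (λ z → X * z + ι k * ι B) (sym (trans (ι-+ B (A ℕ.+ F)) (cong (λ z → ι B + z) (ι-+ A F)))) ⟩
        X * ι (B ℕ.+ (A ℕ.+ F)) + ι k * ι B
          ≡⟨ sym (ι-affine j k (B ℕ.+ (A ℕ.+ F)) B) ⟩
        ι (j ℕ.* (B ℕ.+ (A ℕ.+ F)) ℕ.+ k ℕ.* B)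
          ≡⟨ cong ι (sym (leibniz-tri k c)) ⟩
        ι (evalW tri 0 (linMul k c) j) ∎
        where
        cong₃ : ∀ {u u′ v v′ w w′} → u ≡ u′ → v ≡ v′ → w ≡ w′ →
                X * (u + (v + w)) + ι k * u ≡ X * (u′ + (v′ + w′)) + ι k * u′
        cong₃ refl refl refl = refl

    represents-pochMul : ∀ a {P d1 d2 c} → Represents P d1 d2 c →
      Represents (ι (poch (suc j) a) * P) ((H 1 (a ℕ.+ j) - H 1 j) + d1)
                 ((H 2 (a ℕ.+ j) - H 2 j) + d2) (pochMul a c)
    represents-pochMul zero {P} {d1} {d2} {c} r =
      represents-cong c (sym (ℚ.*-identityˡ P)) (sym (cancel (H 1 j) d1)) (sym (cancel (H 2 j) d2)) r
      where
      cancel : ∀ x d → (x - x) + d ≡ d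
      cancel x d = trans (cong (_+ d) (ℚ.+-inverseʳ x)) (ℚ.+-identityˡ d)
    represents-pochMul (suc a) {P} {d1} {d2} {c} r =
      represents-cong (pochMul (suc a) c) factor (harmonic (H 1) e (H₁-step t)) (harmonic (H 2) (e * e) (H₂-step t))
        (represents-linMul (suc a) e {c = pochMul a c} e-inv (represents-pochMul a r))
      where
      t : ℕ
      t = a ℕ.+ j
      e : ℚ
      e = reciprocal t
      suc-t : ι (suc t) ≡ X + ι (suc a)
      suc-t = trans (cong ι (trans (cong suc (ℕ.+-comm a j)) (sym (ℕ.+-suc j a)))) (ι-+ j (suc a))
      e-inv : e * (X + ι (suc a)) ≡ 1ℚ
      e-inv = trans (cong (e *_) (sym suc-t)) (reciprocal-inverse t)
      factor : ι (poch (suc j) a) * P * (X + ι (suc a)) ≡ ι (poch (suc j) (suc a)) * P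
      factor = begin
        ι (poch (suc j) a) * P * (X + ι (suc a))
          ≡⟨ solve 3 (λ u v w → u :* w :* v := u :* v :* w) refl (ι (poch (suc j) a)) (X + ι (suc a)) P ⟩
        ι (poch (suc j) a) * (X + ι (suc a)) * P
          ≡⟨ cong (λ z → ι (poch (suc j) a) * z * P) (sym (trans (cong ι (cong suc (ℕ.+-comm j a))) suc-t)) ⟩
        ι (poch (suc j) a) * ι (suc j ℕ.+ a) * P
          ≡⟨ cong (_* P) (sym (ι-* (poch (suc j) a) (suc j ℕ.+ a))) ⟩
        ι (poch (suc j) (suc a)) * P ∎
      harmonic : ∀ (G : ℕ → ℚ) f {d} → G (suc t) ≡ G t + f → ((G t - G j) + d) + f ≡ (G (suc t) - G j) + d
      harmonic G f {d} G-step = trans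
        (solve 4 (λ a b c d → ((a :- c) :+ d) :+ b := ((a :+ b) :- c) :+ d) refl (G t) f (G j) d)
        (cong (λ z → (z - G j) + d) (sym G-step))

    represents-pochProd : ∀ as →
      Represents (prodℚ (map (λ a → ι (poch (suc j) a)) as)) (D1 j as) (D2 j as) (pochProd as)
    represents-pochProd []       = refl
      , solve 1 (λ X → X :* con 1ℚ :* con 0ℚ := con 0ℚ) refl X
      , solve 2 (λ X h → con 1ℚ :* (X :* con 0ℚ :+ h :* (con 0ℚ :* con 0ℚ :- con 0ℚ)) := con 0ℚ) refl X h
    represents-pochProd (a ∷ as) = represents-pochMul a (represents-pochProd as)

    term-as-evaluation : ∀ as → term j as ≡ ι (evalW tri 0 (pochProd as) j)
    term-as-evaluation as = proj₂ (proj₂ (represents-pochProd as))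

module Congruence where
  open import Data.Nat using (ℕ; zero; suc; _+_; _*_; _<_; NonZero)
  open import Data.Nat.Properties
  open import Data.Nat.DivMod using (_%_; _/_; %-distribˡ-+; %-distribˡ-*; m≡m%n+[m/n]*n; m*n%n≡0)
  open import Data.Nat.Divisibility using (_∣_; n∣m*n; ∣m+n∣m⇒∣n; m%n≡0⇒n∣m; n∣m⇒m%n≡0)
  open import Data.Nat.Tactic.RingSolver using (solve-∀)
  open import Relation.Binary.Bundles using (Setoid)
  open import Relation.Binary.Structures using (IsEquivalence)
  open import Relation.Binary.PropositionalEquality
  open Sums

  module Modulo (n : ℕ) .{{_ : NonZero n}} where

    -- A record rather than a bare equation, so that x and y are inferable.
    infix 4 _≈_
    record _≈_ (x y : ℕ) : Set where
      constructor mk≈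
      field residues : x % n ≡ y % n

    ≈-reflexive : ∀ {x y} → x ≡ y → x ≈ y
    ≈-reflexive refl = mk≈ refl

    ≈-isEquivalence : IsEquivalence _≈_
    ≈-isEquivalence = record
      { refl  = mk≈ refl
      ; sym   = λ { (mk≈ e) → mk≈ (sym e) }
      ; trans = λ { (mk≈ e) (mk≈ f) → mk≈ (trans e f) }
      }

    ≈-setoid : Setoid _ _
    ≈-setoid = record { isEquivalence = ≈-isEquivalence }

    open IsEquivalence ≈-isEquivalence public
      using () renaming (refl to ≈-refl; sym to ≈-sym; trans to ≈-trans)

    +-cong : ∀ {a b c d} → a ≈ b → c ≈ d → a + c ≈ b + d
    +-cong {a} {b} {c} {d} (mk≈ a≈b) (mk≈ c≈d) = mk≈ (begin
      (a + c) % n             ≡⟨ %-distribˡ-+ a c n ⟩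
      (a % n + c % n) % n     ≡⟨ cong₂ (λ u v → (u + v) % n) a≈b c≈d ⟩
      (b % n + d % n) % n     ≡⟨ %-distribˡ-+ b d n ⟨
      (b + d) % n             ∎)
      where open ≡-Reasoning

    *-cong : ∀ {a b c d} → a ≈ b → c ≈ d → a * c ≈ b * d
    *-cong {a} {b} {c} {d} (mk≈ a≈b) (mk≈ c≈d) = mk≈ (begin
      (a * c) % n             ≡⟨ %-distribˡ-* a c n ⟩
      (a % n * (c % n)) % n   ≡⟨ cong₂ (λ u v → (u * v) % n) a≈b c≈d ⟩
      (b % n * (d % n)) % n   ≡⟨ %-distribˡ-* b d n ⟨
      (b * d) % n             ∎)
      where open ≡-Reasoning

    ∣⇒≈0 : ∀ {x} → n ∣ x → x ≈ 0
    ∣⇒≈0 {x} n∣x = mk≈ (trans (n∣m⇒m%n≡0 x n n∣x) (sym (m*n%n≡0 0 n)))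

    ≈0⇒∣ : ∀ {x} → x ≈ 0 → n ∣ x
    ≈0⇒∣ {x} (mk≈ e) = m%n≡0⇒n∣m x n (trans e (m*n%n≡0 0 n))

    multiple≈0 : ∀ k → k * n ≈ 0
    multiple≈0 k = ∣⇒≈0 (n∣m*n k)

    -- Additive cancellation, in the form available without subtraction.
    cancel : ∀ x y → x + y ≈ y → n ∣ x
    cancel x y (mk≈ e) = ∣m+n∣m⇒∣n (subst (n ∣_) (sym same) (n∣m*n ((x + y) / n))) (n∣m*n (y / n))
      where
      open ≡-Reasoning
      rearrange : ∀ a b c → a + (b + c) ≡ c + (a + b)
      rearrange = solve-∀
      same : (y / n) * n + x ≡ ((x + y) / n) * n
      same = +-cancelˡ-≡ (y % n) _ _ (begin
        y % n + ((y / n) * n + x)         ≡⟨ rearrange (y % n) ((y / n) * n) x ⟩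
        x + (y % n + (y / n) * n)         ≡⟨ cong (x +_) (m≡m%n+[m/n]*n y n) ⟨
        x + y                             ≡⟨ m≡m%n+[m/n]*n (x + y) n ⟩
        (x + y) % n + ((x + y) / n) * n   ≡⟨ cong (_+ ((x + y) / n) * n) e ⟩
        y % n + ((x + y) / n) * n         ∎)

    sum-≈ : ∀ m {f g : ℕ → ℕ} → (∀ i → i < m → f i ≈ g i) → sumTo m f ≈ sumTo m g
    sum-≈ zero    f≈g = ≈-refl
    sum-≈ (suc m) f≈g = +-cong (sum-≈ m (λ i i<m → f≈g i (m<n⇒m<1+n i<m))) (f≈g m (n<1+n m))

    sum-≈0 : ∀ m {f : ℕ → ℕ} → (∀ i → i < m → f i ≈ 0) → sumTo m f ≈ 0
    sum-≈0 m f≈0 = ≈-trans (sum-≈ m f≈0) (≈-reflexive (trans (sum-const m 0) (*-zeroʳ m)))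

module PowerSums where
  open import Data.Nat as ℕ using (ℕ; zero; suc; _+_; _*_; _^_; _∸_; _≤_; _<_; s≤s; z≤n)
  open import Data.Nat.Properties
  open import Data.Nat.Combinatorics using (_C_; nCn≡1; nCk≡nC[n∸k]; nC1≡n)
  open import Data.Nat.Divisibility using (_∣_; ∣⇒≤; m∣m*n)
  open import Data.Nat.Primality using (Prime; euclidsLemma)
  open import Data.Sum using (inj₁; inj₂)
  open import Data.Empty using (⊥-elim)
  open import Relation.Nullary using (¬_)
  open import Relation.Binary.PropositionalEquality
  import Relation.Binary.Reasoning.Setoid as SetoidReasoning
  open Sums
  open Binomial
  open Congruence

  module PrimeModulus (q : ℕ) (prime : Prime (2 + q)) where

    r : ℕ
    r = suc q

    p : ℕ
    p = suc r

    open Modulo p public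
    module ≈-Reasoning = SetoidReasoning ≈-setoid

    ∤-small : ∀ k → 0 < k → k < p → ¬ (p ∣ k)
    ∤-small (suc k) _ k<p p∣k = <⇒≱ k<p (∣⇒≤ p∣k)

    ∣-cancelˡ : ∀ k x → 0 < k → k < p → p ∣ k * x → p ∣ x
    ∣-cancelˡ k x 0<k k<p p∣kx with euclidsLemma k x prime p∣kx
    ... | inj₁ p∣k = ⊥-elim (∤-small k 0<k k<p p∣k)
    ... | inj₂ p∣x = p∣x

    p∣pCk : ∀ k → 0 < k → k < p → p ∣ p C k
    p∣pCk (suc k) _ k<p = ∣-cancelˡ (suc k) (p C suc k) (s≤s z≤n) k<p
      (subst (p ∣_) (sym (C-absorb r k)) (m∣m*n (r C k)))

    fermat : ∀ a → a ^ p ≈ a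
    fermat zero    = ≈-refl
    fermat (suc a) = begin
      suc a ^ p                                  ≡⟨ binomial p a ⟩
      sumTo p g + g p                            ≡⟨ cong (_+ g p) (sum-unfoldˡ r g) ⟩
      1 + sumTo r (λ i → g (suc i)) + g p        ≈⟨ +-cong (+-cong ≈-refl middle) (≈-reflexive top) ⟩
      1 + 0 + a ^ p                              ≈⟨ +-cong ≈-refl (fermat a) ⟩
      suc a                                      ∎
      where
      open ≈-Reasoning
      g : ℕ → ℕ
      g k = (p C k) * a ^ k
      middle : sumTo r (λ i → g (suc i)) ≈ 0
      middle = sum-≈0 r (λ i i<r → *-cong (∣⇒≈0 (p∣pCk (suc i) (s≤s z≤n) (s≤s i<r))) (≈-refl {a ^ suc i}))
      top : g p ≡ a ^ p
      top = trans (cong (_* a ^ p) (nCn≡1 p)) (*-identityˡ (a ^ p))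

    fermat-unit : ∀ j → 0 < j → j < p → j ^ r ≈ 1
    fermat-unit j 0<j j<p = begin
      j ^ r                    ≡⟨ m∸n+n≡m 1≤j^r ⟨
      (j ^ r ∸ 1) + 1          ≈⟨ +-cong (∣⇒≈0 p∣j^r-1) ≈-refl ⟩
      1                        ∎
      where
      open ≈-Reasoning
      1≤j^r : 1 ≤ j ^ r
      1≤j^r = m^n>0 j r
        where instance _ = ℕ.>-nonZero 0<j
      j[j^r-1]+j : j * (j ^ r ∸ 1) + j ≡ j ^ p
      j[j^r-1]+j = trans (cong (j * (j ^ r ∸ 1) +_) (sym (*-identityʳ j)))
                  (trans (sym (*-distribˡ-+ j (j ^ r ∸ 1) 1)) (cong (j *_) (m∸n+n≡m 1≤j^r)))
      p∣j^r-1 : p ∣ j ^ r ∸ 1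
      p∣j^r-1 = ∣-cancelˡ j (j ^ r ∸ 1) 0<j j<p
        (cancel (j * (j ^ r ∸ 1)) j (≈-trans (≈-reflexive j[j^r-1]+j) (fermat j)))

    -- The power sums S m = Σ_{j<p} j^m (with 0⁰ = 1).
    S : ℕ → ℕ
    S m = sumTo p (λ j → j ^ m)

    -- Σ_{k ≤ m} C(m+1,k)·S k = p^(m+1), from Σ_j ((j+1)^(m+1) - j^(m+1)) = p^(m+1).
    powerSum-recurrence : ∀ m → sumTo (suc m) (λ k → (suc m C k) * S k) ≡ p ^ suc m
    powerSum-recurrence m = +-cancelʳ-≡ (S (suc m)) _ _ (begin
      sumTo (suc m) (λ k → (suc m C k) * S k) + S (suc m)
        ≡⟨ cong (sumTo (suc m) (λ k → (suc m C k) * S k) +_)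
                (sym (trans (cong (_* S (suc m)) (nCn≡1 (suc m))) (*-identityˡ _))) ⟩
      sumTo (suc (suc m)) (λ k → (suc m C k) * S k)
        ≡⟨ sum-cong (suc (suc m)) (λ k _ → sym (sum-* p (suc m C k) (λ j → j ^ k))) ⟩
      sumTo (suc (suc m)) (λ k → sumTo p (λ j → (suc m C k) * j ^ k))
        ≡⟨ sym (sum-swap p (suc (suc m)) (λ j k → (suc m C k) * j ^ k)) ⟩
      sumTo p (λ j → sumTo (suc (suc m)) (λ k → (suc m C k) * j ^ k))
        ≡⟨ sum-cong p (λ j _ → sym (binomial (suc m) j)) ⟩
      sumTo p (λ j → suc j ^ suc m)
        ≡⟨ +-identityʳ _ ⟨
      sumTo p (λ j → suc j ^ suc m) + 0 ^ suc m
        ≡⟨ sum-telescope p (λ j → j ^ suc m) ⟩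
      S (suc m) + p ^ suc m
        ≡⟨ +-comm (S (suc m)) (p ^ suc m) ⟩
      p ^ suc m + S (suc m) ∎)
      where open ≡-Reasoning

    C[n+1,n]≡n+1 : ∀ n → suc n C n ≡ suc n
    C[n+1,n]≡n+1 n = trans (nCk≡nC[n∸k] (n≤1+n n)) (trans (cong (suc n C_) (m+n∸n≡m 1 n)) (nC1≡n (suc n)))

    -- S k ≡ 0 for k < p - 1: by course-of-values induction, the recurrence
    -- for m = k leaves the single term (k+1)·S k, and p ∤ k + 1.
    powerSum-vanishes : ∀ k → k < r → S k ≈ 0
    powerSum-vanishes k k<r = below k k<r k ≤-refl
      where
      below : ∀ m → m < r → ∀ k → k ≤ m → S k ≈ 0
      below zero    _    zero z≤n = ≈-trans (≈-reflexive (sum-const p 1)) (∣⇒≈0 (m∣m*n 1))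
      below (suc m) m<r k k≤m with m≤n⇒m<n∨m≡n k≤m
      ... | inj₁ k<m  = below m (<⇒≤ m<r) k (≤-pred k<m)
      ... | inj₂ refl = ∣⇒≈0 (∣-cancelˡ (suc (suc m)) (S (suc m)) (s≤s z≤n) (s≤s m<r) (≈0⇒∣ leading≈0))
        where
        open ≈-Reasoning
        t : ℕ → ℕ
        t k = (suc (suc m) C k) * S k
        lower≈0 : sumTo (suc m) t ≈ 0
        lower≈0 = sum-≈0 (suc m) (λ k k<m →
          ≈-trans (*-cong (≈-refl {suc (suc m) C k}) (below m (<⇒≤ m<r) k (≤-pred k<m)))
                  (≈-reflexive (*-zeroʳ (suc (suc m) C k))))
        leading≈0 : suc (suc m) * S (suc m) ≈ 0
        leading≈0 = begin
          suc (suc m) * S (suc m)                   ≈⟨ ≈-sym (+-cong lower≈0 ≈-refl) ⟩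
          sumTo (suc m) t + suc (suc m) * S (suc m) ≡⟨ cong (λ c → sumTo (suc m) t + c * S (suc m)) (sym (C[n+1,n]≡n+1 (suc m))) ⟩
          sumTo (suc (suc m)) t                     ≡⟨ powerSum-recurrence (suc m) ⟩
          p ^ suc (suc m)                           ≈⟨ ∣⇒≈0 (m∣m*n (p ^ suc m)) ⟩
          0                                         ∎

    -- S (p-1) ≡ p - 1: every nonzero j contributes j^(p-1) ≡ 1.
    powerSum-top : S r ≈ r
    powerSum-top = begin
      S r                              ≡⟨ sum-unfoldˡ r (λ j → j ^ r) ⟩
      sumTo r (λ i → suc i ^ r)        ≈⟨ sum-≈ r (λ i i<r → fermat-unit (suc i) (s≤s z≤n) (s≤s i<r)) ⟩
      sumTo r (λ _ → 1)                ≡⟨ trans (sum-const r 1) (*-identityʳ r) ⟩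
      r                                ∎
      where open ≈-Reasoning

    powerSum-periodic : ∀ m → S (m + p) ≈ S (suc m)
    powerSum-periodic m = sum-≈ p (λ j _ → begin
      j ^ (m + p)          ≡⟨ ^-distribˡ-+-* j m p ⟩
      j ^ m * j ^ p        ≈⟨ *-cong (≈-refl {j ^ m}) (fermat j) ⟩
      j ^ m * j            ≡⟨ *-comm (j ^ m) j ⟩
      j ^ suc m            ∎)
      where open ≈-Reasoning

module Moments where
  open import Data.Nat using (ℕ; zero; suc; _+_; _*_; _^_; _∸_; _≤_; _<_; s≤s; z≤n)
  open import Data.Nat.Properties
  open import Data.Nat.Divisibility using (_∣_; m∣m*n)
  open import Data.Nat.Primality using (Prime; euclidsLemma)
  open import Data.Nat.Tactic.RingSolver using (solve-∀)
  open import Data.List using (List; []; _∷_)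
  open import Data.Nat.ListAction using (sum)
  open import Data.Product using (proj₁; proj₂)
  open import Data.Sum using (inj₁; inj₂)
  open import Data.Empty using (⊥-elim)
  open import Relation.Binary.Definitions using (tri<; tri≈; tri>)
  open import Relation.Binary.PropositionalEquality
  open Sums
  open Poly
  open PowerSums

  -- Modulo an odd prime p = s + 3 (so r = p - 1 = s + 2), the sum over
  -- j < p of Σₖ cₖ·tri(k)·jᵏ only sees the coefficient of degree 2(p-1).
  module OddPrime (s : ℕ) (prime : Prime (3 + s)) where

    open PrimeModulus (suc s) prime

    M : ℕ
    M = 2 * r

    -- tri (p-1) = (p-1)p/2 ≡ 0, since p is odd.
    tri-r≈0 : tri r ≈ 0
    tri-r≈0 with euclidsLemma (tri r) 2 prime (subst (p ∣_) (sym (trans (tri-closed r) (*-comm r p))) (m∣m*n r))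
    ... | inj₁ p∣tri = ∣⇒≈0 p∣tri
    ... | inj₂ p∣2   = ⊥-elim (∤-small 2 (s≤s z≤n) (s≤s (s≤s (s≤s z≤n))) p∣2)

    -- tri (2(p-1)) = (p-1)(2p-1) = 1 + (2p-3)·p.
    tri-M : tri M ≡ 1 + (2 * s + 3) * p
    tri-M = *-cancelʳ-≡ _ _ 2 (trans (tri-closed M) (expand s))
      where
      expand : ∀ s → (2 * suc (suc s)) * suc (2 * suc (suc s)) ≡ (1 + (2 * s + 3) * suc (suc (suc s))) * 2
      expand = solve-∀

    -- Below degree M every weighted power sum vanishes: for n < p - 1 the
    -- power sum does, for n = p - 1 the weight does, and for p ≤ n < M the
    -- power sum reduces by periodicity to one of degree n - p + 1 < p - 1.
    weighted-powerSum-low : ∀ n → n < M → tri n * S n ≈ 0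
    weighted-powerSum-low n n<M with <-cmp n r
    ... | tri< n<r _ _  = ≈-trans (*-cong (≈-refl {tri n}) (powerSum-vanishes n n<r)) (≈-reflexive (*-zeroʳ (tri n)))
    ... | tri≈ _ refl _ = *-cong tri-r≈0 (≈-refl {S r})
    ... | tri> _ _ r<n  = ≈-trans (*-cong (≈-refl {tri n}) S-n≈0) (≈-reflexive (*-zeroʳ (tri n)))
      where
      m : ℕ
      m = n ∸ p
      m+p≡n : m + p ≡ n
      m+p≡n = m∸n+n≡m r<n
      m+1<r : suc m < r
      m+1<r = +-cancelʳ-≤ r (suc (suc m)) r (begin
        suc (suc m) + r    ≡⟨ cong suc (sym (+-suc m r)) ⟩
        suc (m + p)        ≡⟨ cong suc m+p≡n ⟩
        suc n              ≤⟨ n<M ⟩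
        2 * r              ≡⟨ cong (r +_) (+-identityʳ r) ⟩
        r + r              ∎)
        where open ≤-Reasoning
      S-n≈0 : S n ≈ 0
      S-n≈0 = ≈-trans (≈-reflexive (cong S (sym m+p≡n)))
                      (≈-trans (powerSum-periodic m) (powerSum-vanishes (suc m) m+1<r))

    -- At degree M: tri M ≡ 1 and S M ≡ S (p-1) ≡ p - 1.
    weighted-powerSum-top : tri M * S M ≈ r
    weighted-powerSum-top = begin
      tri M * S M                        ≈⟨ *-cong tri-M≈1 S-M≈r ⟩
      1 * r                              ≡⟨ *-identityˡ r ⟩
      r                                  ∎
      where
      open ≈-Reasoning
      tri-M≈1 : tri M ≈ 1
      tri-M≈1 = ≈-trans (≈-reflexive tri-M) (+-cong (≈-refl {1}) (multiple≈0 (2 * s + 3)))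
      M≡ : M ≡ suc s + p
      M≡ = rearrange s
        where
        rearrange : ∀ s → 2 * suc (suc s) ≡ suc s + suc (suc (suc s))
        rearrange = solve-∀
      S-M≈r : S M ≈ r
      S-M≈r = ≈-trans (≈-reflexive (cong S M≡)) (≈-trans (powerSum-periodic (suc s)) powerSum-top)

    pairS : (ℕ → ℕ) → ℕ → List ℕ → ℕ
    pairS w o []       = 0
    pairS w o (c ∷ cs) = c * w o * S o + pairS w (suc o) cs

    sum-evalW : ∀ w o c → sumTo p (λ j → evalW w o c j) ≡ pairS w o c
    sum-evalW w o []       = trans (sum-const p 0) (*-zeroʳ p)
    sum-evalW w o (c ∷ cs) = trans (sum-+ p (λ j → c * w o * j ^ o) (λ j → evalW w (suc o) cs j))
      (cong₂ _+_ (sum-* p (c * w o) (λ j → j ^ o)) (sum-evalW w (suc o) cs))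

    DegreeAtMost : ℕ → List ℕ → Set
    DegreeAtMost o c = ∀ i → M < o + i → coef c i ≡ 0

    degree-tail : ∀ o x cs → DegreeAtMost o (x ∷ cs) → DegreeAtMost (suc o) cs
    degree-tail o x cs bound i M<o+1+i = bound (suc i) (subst (M <_) (sym (+-suc o i)) M<o+1+i)

    pairS-beyond : ∀ o c → M < o → DegreeAtMost o c → pairS tri o c ≡ 0
    pairS-beyond o []       _   _     = refl
    pairS-beyond o (x ∷ cs) M<o bound
      rewrite bound 0 (subst (M <_) (sym (+-identityʳ o)) M<o) =
      pairS-beyond (suc o) cs (m<n⇒m<1+n M<o) (degree-tail o x cs bound)

    ∸-suc : ∀ m o → o < m → m ∸ o ≡ suc (m ∸ suc o)
    ∸-suc (suc m) zero    _         = refl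
    ∸-suc (suc m) (suc o) (s≤s o<m) = ∸-suc m o o<m

    pairS-extract : ∀ o c → o ≤ M → DegreeAtMost o c → pairS tri o c ≈ coef c (M ∸ o) * r
    pairS-extract o []       _   _ = ≈-refl
    pairS-extract o (x ∷ cs) o≤M bound with m≤n⇒m<n∨m≡n o≤M
    ... | inj₁ o<M = begin
      x * tri o * S o + pairS tri (suc o) cs  ≈⟨ +-cong low (pairS-extract (suc o) cs o<M (degree-tail o x cs bound)) ⟩
      0 + coef cs (M ∸ suc o) * r             ≡⟨ cong (λ z → coef (x ∷ cs) z * r) (sym (∸-suc M o o<M)) ⟩
      coef (x ∷ cs) (M ∸ o) * r               ∎
      where
      open ≈-Reasoning
      low : x * tri o * S o ≈ 0
      low = ≈-trans (≈-reflexive (*-assoc x (tri o) (S o)))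
            (≈-trans (*-cong (≈-refl {x}) (weighted-powerSum-low o o<M)) (≈-reflexive (*-zeroʳ x)))
    ... | inj₂ refl = begin
      x * tri M * S M + pairS tri (suc M) cs  ≡⟨ cong (x * tri M * S M +_) (pairS-beyond (suc M) cs (n<1+n M) (degree-tail M x cs bound)) ⟩
      x * tri M * S M + 0                     ≡⟨ +-identityʳ _ ⟩
      x * tri M * S M                         ≡⟨ *-assoc x (tri M) (S M) ⟩
      x * (tri M * S M)                       ≈⟨ *-cong (≈-refl {x}) weighted-powerSum-top ⟩
      x * r                                   ≡⟨ cong (λ z → coef (x ∷ cs) z * r) (sym (n∸n≡0 M)) ⟩
      coef (x ∷ cs) (M ∸ M) * r               ∎
      where open ≈-Reasoning

    sum-evalW-tri : ∀ c → (∀ i → M < i → coef c i ≡ 0) → sumTo p (λ j → evalW tri 0 c j) ≈ coef c M * r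
    sum-evalW-tri c bound = ≈-trans (≈-reflexive (sum-evalW tri 0 c)) (pairS-extract 0 c z≤n bound)

    pochProd-sum : ∀ as → sum as ≤ M → sumTo p (λ j → evalW tri 0 (pochProd as) j) ≈ coef (pochProd as) M * r
    pochProd-sum as T≤M = sum-evalW-tri (pochProd as) (λ i M<i → proj₁ (monic-pochProd as) i (≤-<-trans T≤M M<i))

    pochProd-sum-below : ∀ as → sum as < M → p ∣ sumTo p (λ j → evalW tri 0 (pochProd as) j)
    pochProd-sum-below as T<M = ≈0⇒∣ (≈-trans (pochProd-sum as (<⇒≤ T<M))
      (≈-reflexive (cong (_* r) (proj₁ (monic-pochProd as) M T<M))))

    pochProd-sum-top : ∀ as → sum as ≡ M → p ∣ sumTo p (λ j → evalW tri 0 (pochProd as) j) + 1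
    pochProd-sum-top as T≡M = ≈0⇒∣ (begin
      sumTo p (λ j → evalW tri 0 (pochProd as) j) + 1 ≈⟨ +-cong (pochProd-sum as (≤-reflexive T≡M)) (≈-refl {1}) ⟩
      coef (pochProd as) M * r + 1                    ≡⟨ cong (λ d → coef (pochProd as) d * r + 1) (sym T≡M) ⟩
      coef (pochProd as) (sum as) * r + 1             ≡⟨ cong (λ c → c * r + 1) (proj₂ (monic-pochProd as)) ⟩
      1 * r + 1                                       ≡⟨ trans (cong (_+ 1) (*-identityˡ r)) (trans (+-comm r 1) (sym (*-identityˡ p))) ⟩
      1 * p                                           ≈⟨ multiple≈0 1 ⟩
      0                                               ∎)
      where open ≈-Reasoning

open import Defs
open import Data.Nat using (ℕ; _≤_; _<_; _*_; _∸_)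
open import Data.Nat.Primality using (Prime)
open import Data.List using (List)
open import Data.Nat.ListAction using (sum)
open import Data.List.Relation.Unary.All using (All)
open import Data.Product using (_×_)
open import Relation.Binary.PropositionalEquality using (_≡_; _≢_)
open import Data.Rational using (0ℚ; -_; 1ℚ)

open import Data.Nat as ℕ using (zero; suc; s≤s; z≤n)
open import Data.Nat.Divisibility using (_∣_)
open import Data.Nat.Primality using (prime⇒nonTrivial)
import Data.Integer as ℤ
open import Data.Rational as ℚ using (ℚ; ↥_; _+_)
import Data.Rational.Properties as ℚ
open import Data.List using (map; applyUpTo)
open import Data.Product using (_,_)
open import Data.Empty using (⊥-elim)
open import Function using (_∘_; id)
open import Relation.Binary.PropositionalEquality using (refl; sym; trans; cong; cong₂; subst)
open Sums
open Poly
open Embed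
open Summand
open Moments

sumℚ-applyUpTo : ∀ (h : ℕ → ℚ) (g : ℕ → ℕ) → (∀ j → h j ≡ ι (g j)) →
  ∀ n f → sumℚ (map h (applyUpTo f n)) ≡ ι (sumTo n (g ∘ f))
sumℚ-applyUpTo h g h≡ιg zero    f = refl
sumℚ-applyUpTo h g h≡ιg (suc n) f = trans
  (cong₂ _+_ (h≡ιg (f 0)) (sumℚ-applyUpTo h g h≡ιg n (f ∘ suc)))
  (trans (sym (ι-+ (g (f 0)) (sumTo n (g ∘ f ∘ suc)))) (cong ι (sym (sum-unfoldˡ n (g ∘ f)))))

S-natural : ∀ p as → S p as ≡ ι (sumTo p (λ j → evalW tri 0 (pochProd as) j))
S-natural p as = sumℚ-applyUpTo (λ j → term j as) (λ j → evalW tri 0 (pochProd as) j)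
                                (λ j → AtPoint.term-as-evaluation j as) p id

ι-≡0 : ∀ p N → p ∣ N → ι N ≡ 0ℚ [modℚ p ]
ι-≡0 p N p∣N = subst (λ z → p ∣ ℤ.∣ z ∣) (sym (trans (cong ↥_ (ℚ.+-identityʳ (ι N))) (↥ι N))) p∣N

ι-≡-1 : ∀ p N → p ∣ N ℕ.+ 1 → ι N ≡ - 1ℚ [modℚ p ]
ι-≡-1 p N p∣N+1 = subst (λ z → p ∣ ℤ.∣ z ∣) (sym (trans (cong ↥_ (sym (ι-+ N 1))) (↥ι (N ℕ.+ 1)))) p∣N+1

odd-prime-case : ∀ s → Prime (3 ℕ.+ s) → ∀ as →
    (sum as < 2 * (2 ℕ.+ s) → S (3 ℕ.+ s) as ≡ 0ℚ [modℚ 3 ℕ.+ s ]) ×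
    (sum as ≡ 2 * (2 ℕ.+ s) → S (3 ℕ.+ s) as ≡ - 1ℚ [modℚ 3 ℕ.+ s ])
odd-prime-case s p-prime as =
    (λ T<M → subst (_≡ 0ℚ [modℚ p ]) (sym (S-natural p as)) (ι-≡0 p N (pochProd-sum-below as T<M)))
  , (λ T≡M → subst (_≡ - 1ℚ [modℚ p ]) (sym (S-natural p as)) (ι-≡-1 p N (pochProd-sum-top as T≡M)))
  where
  open OddPrime s p-prime using (pochProd-sum-below; pochProd-sum-top)
  p N : ℕ
  p = 3 ℕ.+ s
  N = sumTo p (λ j → evalW tri 0 (pochProd as) j)

-- Lemma 3.16.  A prime other than 2 has the form s + 3; neither aᵢ ≥ 1 nor
-- the bound T ≤ 2(p-1) is needed beyond the two cases considered.
lemma3p16 : (p : ℕ) → Prime p → p ≢ 2 →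
    (as : List ℕ) → All (λ a → 1 ≤ a) as → sum as ≤ 2 * (p ∸ 1) →
    (sum as < 2 * (p ∸ 1) → S p as ≡ 0ℚ [modℚ p ]) ×
    (sum as ≡ 2 * (p ∸ 1) → S p as ≡ - 1ℚ [modℚ p ])
lemma3p16 p p-prime p≢2 as _ _ with ℕ.nonTrivial⇒n>1 p {{prime⇒nonTrivial p-prime}}
... | s≤s (s≤s {n = zero}  z≤n) = ⊥-elim (p≢2 refl)
... | s≤s (s≤s {n = suc s} z≤n) = odd-prime-case s p-prime as
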